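{- If $G$ is a finite connected graph with $\mathrm{diam}(G)\ge 3$ and $\delta(G)\le c(G)$, then $c_H(G)\le c(G)+1$.
   Context: $\delta(G)$ is the minimum degree of $G$ and $c(G)$ is the usual cop number of $G$ (classical Cops and Robbers with the robber always visible). Hyperopic Cops and Robbers on a finite connected simple graph $G$: one player controls $k$ cops, the other a single robber. The cops first choose starting vertices (several cops may share a vertex), then the robber chooses a starting vertex; afterwards, in each round, each cop moves to an adjacent vertex or stays put, and then the robber moves to an adjacent vertex or stays put. The robber always knows the cops' positions. The robber is invisible to the cops exactly when the robber's vertex is adjacent to the vertex of every cop (a robber on the same vertex as a cop is visible); otherwise the cops see the robber's position. The cops win if after finitely many rounds some cop occupies the robber's vertex, and the cops' strategy must guarantee this with certainty (no chance allowed). The hyperopic cop number $c_H(G)$ is the minimum $k$ for which $k$ cops have a winning strategy. -}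

module Defs where

open import Data.Nat using (ℕ; zero; suc; _≤_; _⊓_)
open import Data.Fin using (Fin)
open import Data.Bool using (Bool; true; false; if_then_else_)
open import Data.List using (List; []; _∷_; map; foldr; allFin)
open import Data.Nat.ListAction using (sum)
open import Data.Bool.ListAction using (all)
open import Data.Maybe using (Maybe; just; nothing)
open import Data.Product using (Σ; ∃; ∃-syntax; _×_; _,_)
open import Data.Sum using (_⊎_)
open import Relation.Nullary using (¬_)
open import Relation.Binary.PropositionalEquality using (_≡_)

record Graph : Set where
  field
    n      : ℕ
    adj    : Fin n → Fin n → Bool
    sym    : ∀ u v → adj u v ≡ adj v u
    irrefl : ∀ v → adj v v ≡ false

module _ (G : Graph) where
  open Graph G

  Adj : Fin n → Fin n → Set
  Adj u v = adj u v ≡ true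

  data Walk : Fin n → Fin n → ℕ → Set where
    nil  : ∀ {u} → Walk u u 0
    cons : ∀ {u w v ℓ} → Adj u w → Walk w v ℓ → Walk u v (suc ℓ)

  Connected : Set
  Connected = ∀ u v → ∃[ ℓ ] Walk u v ℓ

  Dist≤ : ℕ → Fin n → Fin n → Set
  Dist≤ d u v = ∃[ ℓ ] (ℓ ≤ d × Walk u v ℓ)

  Diam≥3 : Set
  Diam≥3 = ∃[ u ] ∃[ v ] ¬ Dist≤ 2 u v

  degree : Fin n → ℕ
  degree v = sum (map (λ u → if adj v u then 1 else 0) (allFin n))

  -- δ(G): minimum degree (foldr starting from n, an upper bound on all degrees)
  minDegree : ℕ
  minDegree = foldr _⊓_ n (map degree (allFin n))

  Config : ℕ → Set
  Config k = Fin k → Fin n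

  Move : ∀ {k} → Config k → Config k → Set
  Move C C' = ∀ i → C' i ≡ C i ⊎ Adj (C i) (C' i)

  RobberWalk : (ℕ → Fin n) → Set
  RobberWalk r = ∀ t → r (suc t) ≡ r t ⊎ Adj (r t) (r (suc t))

  -- what the cops observe about the robber: just r if visible, nothing if not
  Observation : Set
  Observation = Maybe (Fin n)

  ObsRule : ℕ → Set
  ObsRule k = Config k → Fin n → Observation

  fullObs : ∀ k → ObsRule k
  fullObs k C r = just r

  hyperObs : ∀ k → ObsRule k
  hyperObs k C r = if all (λ i → adj (C i) r) (allFin k) then nothing else just r

  -- deterministic cop strategy: initial placement and, given the observation
  -- history (most recent first) and the current configuration, the next one.
  record Strategy (k : ℕ) : Set where
    field
      start : Config k
      next  : List Observation → Config k → Config k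
      legal : ∀ h C → Move C (next h C)

  module Play {k : ℕ} (O : ObsRule k) (σ : Strategy k) (r : ℕ → Fin n) where
    open Strategy σ
    mutual
      cops : ℕ → Config k
      cops zero    = start
      cops (suc t) = next (hist t) (cops t)

      hist : ℕ → List Observation
      hist zero    = O start (r 0) ∷ []
      hist (suc t) = O (cops (suc t)) (r (suc t)) ∷ O (cops (suc t)) (r t) ∷ hist t

    -- capture at time t: after the robber's (placement or) move in round t,
    -- or after the cops' move in round t+1
    CaughtAt : ℕ → Set
    CaughtAt t = (∃[ i ] cops t i ≡ r t) ⊎ (∃[ i ] cops (suc t) i ≡ r t)

  CopsWin : (k : ℕ) → ObsRule k → Set
  CopsWin k O = Σ (Strategy k) λ σ →
    ∀ (r : ℕ → Fin n) → RobberWalk r → ∃[ t ] Play.CaughtAt O σ r t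

  ClassicalWin : ℕ → Set
  ClassicalWin k = CopsWin k (fullObs k)

  HyperopicWin : ℕ → Set
  HyperopicWin k = CopsWin k (hyperObs k)

  IsCopNumber : ℕ → Set
  IsCopNumber k = ClassicalWin k × (∀ j → ClassicalWin j → k ≤ j)

-- Let u be a vertex of minimum degree δ(G) ≤ c(G). One extra cop guards u
-- forever while the other c(G) cops play a classical winning strategy, which
-- works verbatim as long as the robber stays visible. If the robber ever turns
-- invisible, it is adjacent to every cop, in particular to u; the c(G) ≥ δ(G)
-- remaining cops have each been assigned a different neighbour of u, and the
-- cop assigned to the robber's vertex, being adjacent to it, steps onto it.
module Submission where

open import Defs
open import Data.Nat using (ℕ; zero; suc; _≤_; s≤s)
open import Data.Nat.Properties using (≤-refl; ≤-trans; m≤n⇒m≤1+n; ⊓-sel; anyUpTo?; module ≤-Reasoning)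
open import Data.Nat.ListAction using (sum)
open import Data.Bool using (Bool; true; false; if_then_else_; T)
open import Data.Bool.Properties using (T-≡)
open import Data.Bool.ListAction using (all)
open import Data.Fin using (Fin; zero; suc; toℕ; inject≤)
open import Data.Fin.Properties using (toℕ-inject≤)
open import Data.List using (List; []; _∷_; map; allFin; length; lookup; filterᵇ)
open import Data.List.Properties using (length-filter; length-tabulate)
import Data.List.Relation.Unary.All as All
open import Data.List.Relation.Unary.All.Properties using (all⁺)
open import Data.List.Relation.Unary.Any using (index)
open import Data.List.Relation.Unary.Any.Properties using (lookup-index)
open import Data.List.Membership.Propositional using (_∈_)
open import Data.List.Membership.Propositional.Properties
  using (∈-allFin; ∈-filter⁺; ∈-map⁻; foldr-selective)
open import Data.Maybe using (Maybe; just; nothing)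
open import Data.Product using (∃-syntax; _×_; _,_)
open import Data.Sum using (_⊎_; inj₁; inj₂)
open import Data.Empty using (⊥-elim)
open import Data.Vec.Functional as Vector using (tail)
open import Function using (Equivalence; _∘_)
open import Relation.Nullary using (¬_; Dec; yes; no; T?)
open import Relation.Binary.PropositionalEquality

module _ {A : Set} where

  double : List A → List A
  double [] = []
  double (x ∷ xs) = x ∷ x ∷ double xs

  everyOther : List A → List A
  everyOther [] = []
  everyOther (x ∷ []) = x ∷ []
  everyOther (x ∷ _ ∷ xs) = x ∷ everyOther xs

  nth : List A → ℕ → Maybe A
  nth [] _ = nothing
  nth (x ∷ _) zero = just x
  nth (_ ∷ xs) (suc k) = nth xs k

  nth-toℕ : ∀ xs (i : Fin (length xs)) → nth xs (toℕ i) ≡ just (lookup xs i)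
  nth-toℕ (x ∷ xs) zero = refl
  nth-toℕ (x ∷ xs) (suc i) = nth-toℕ xs i

  length-filterᵇ : ∀ (p : A → Bool) xs →
    length (filterᵇ p xs) ≡ sum (map (λ x → if p x then 1 else 0) xs)
  length-filterᵇ p [] = refl
  length-filterᵇ p (x ∷ xs) with p x
  ... | true = cong suc (length-filterᵇ p xs)
  ... | false = length-filterᵇ p xs

T-all-allFin : ∀ {k} (p : Fin k → Bool) → T (all p (allFin k)) → ∀ i → T (p i)
T-all-allFin p h i = All.lookup (all⁺ p _ h) (∈-allFin i)

module _ (G : Graph) where
  open Graph G using (n; adj)

  neighbours : Fin n → List (Fin n)
  neighbours u = filterᵇ (adj u) (allFin n)

  length-neighbours : ∀ u → length (neighbours u) ≡ degree G u
  length-neighbours u = length-filterᵇ (adj u) (allFin n)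

  degree≤n : ∀ u → degree G u ≤ n
  degree≤n u = begin
    degree G u              ≡⟨ length-neighbours u ⟨
    length (neighbours u)   ≤⟨ length-filter _ (allFin n) ⟩
    length (allFin n)       ≡⟨ length-tabulate _ ⟩
    n                       ∎
    where open ≤-Reasoning

  minDegree-attained : Fin n → ∃[ u ] degree G u ≤ minDegree G
  minDegree-attained v with foldr-selective ⊓-sel n (map (degree G) (allFin n))
  ... | inj₁ δ≡n = v , subst (degree G v ≤_) (sym δ≡n) (degree≤n v)
  ... | inj₂ δ∈degrees with ∈-map⁻ (degree G) δ∈degrees
  ...   | u , _ , δ≡deg = u , subst (_≤ minDegree G) δ≡deg ≤-refl

  Hidden : ∀ {k} → Config G k → Fin n → Set
  Hidden {k} C r = T (all (λ i → adj (C i) r) (allFin k))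

  hyperObs-visible : ∀ {k} C r → ¬ Hidden C r → hyperObs G k C r ≡ just r
  hyperObs-visible {k} C r visible with all (λ i → adj (C i) r) (allFin k)
  ... | true = ⊥-elim (visible _)
  ... | false = refl

  hyperObs-hidden : ∀ {k} C r → Hidden C r → hyperObs G k C r ≡ nothing
  hyperObs-hidden {k} C r hidden with all (λ i → adj (C i) r) (allFin k)
  ... | true = refl

  moveOnto : Fin n → Maybe (Fin n) → Fin n
  moveOnto p nothing = p
  moveOnto p (just y) = if adj p y then y else p

  moveOnto-legal : ∀ p m → moveOnto p m ≡ p ⊎ Adj G p (moveOnto p m)
  moveOnto-legal p nothing = inj₁ refl
  moveOnto-legal p (just y) with adj p y in p~y
  ... | true = inj₂ p~y
  ... | false = inj₁ refl

  moveOnto-adjacent : ∀ p y → Adj G p y → moveOnto p (just y) ≡ y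
  moveOnto-adjacent p y p~y rewrite p~y = refl

  hiddenNow : List (Observation G) → Bool
  hiddenNow (nothing ∷ _) = true
  hiddenNow _ = false

  -- The classical history after round t is r t ∷ r (t-1) ∷ r (t-1) ∷ … ∷ r 0 ∷ r 0,
  -- since each round records the robber's new position and, after the cops' move,
  -- its unchanged one.
  replay : List (Observation G) → List (Observation G)
  replay [] = []
  replay (x ∷ xs) = x ∷ double xs

  -- The cops' first observation of each round is of the robber's current position.
  classicalHistory : List (Observation G) → List (Observation G)
  classicalHistory h = replay (everyOther h)

  module Guarded (c : ℕ) (σ : Strategy G c) (u : Fin n) where
    module σ = Strategy σ

    ambush : Config G (suc c) → Config G (suc c)
    ambush C zero = C zero
    ambush C (suc i) = moveOnto (C (suc i)) (nth (neighbours u) (toℕ i))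

    simulate : List (Observation G) → Config G (suc c) → Config G (suc c)
    simulate h C = C zero Vector.∷ σ.next (classicalHistory h) (tail C)

    next : List (Observation G) → Config G (suc c) → Config G (suc c)
    next h C = if hiddenNow h then ambush C else simulate h C

    legal : ∀ h C → Move G C (next h C)
    legal h C i with hiddenNow h
    legal h C zero    | true  = inj₁ refl
    legal h C (suc i) | true  = moveOnto-legal (C (suc i)) (nth (neighbours u) (toℕ i))
    legal h C zero    | false = inj₁ refl
    legal h C (suc i) | false = σ.legal (classicalHistory h) (tail C) i

    guarded : Strategy G (suc c)
    guarded = record { start = u Vector.∷ σ.start ; next = next ; legal = legal }

    module _ (r : ℕ → Fin n) where
      module H = Play G (hyperObs G (suc c)) guarded r
      module C = Play G (fullObs G c) σ r

      HiddenAt : ℕ → Set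
      HiddenAt t = Hidden (H.cops t) (r t)

      VisibleUpTo : ℕ → Set
      VisibleUpTo t = ∀ {s} → s ≤ t → ¬ HiddenAt s

      guard-stays : ∀ t → H.cops t zero ≡ u
      guard-stays zero = refl
      guard-stays (suc t) with hiddenNow (H.hist t)
      ... | true = guard-stays t
      ... | false = guard-stays t

      hiddenNow-hist : ∀ t → hiddenNow (H.hist t) ≡ hiddenNow (hyperObs G (suc c) (H.cops t) (r t) ∷ [])
      hiddenNow-hist zero = refl
      hiddenNow-hist (suc t) with hyperObs G (suc c) (H.cops (suc t)) (r (suc t))
      ... | just _ = refl
      ... | nothing = refl

      cops-visible : ∀ t → ¬ HiddenAt t → H.cops (suc t) ≡ simulate (H.hist t) (H.cops t)
      cops-visible t visible
        rewrite hiddenNow-hist t | hyperObs-visible (H.cops t) (r t) visible = refl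

      cops-hidden : ∀ t → HiddenAt t → H.cops (suc t) ≡ ambush (H.cops t)
      cops-hidden t hidden
        rewrite hiddenNow-hist t | hyperObs-hidden (H.cops t) (r t) hidden = refl

      trace : ℕ → List (Observation G)
      trace zero = just (r zero) ∷ []
      trace (suc t) = just (r (suc t)) ∷ trace t

      everyOther-hist : ∀ t → VisibleUpTo t → everyOther (H.hist t) ≡ trace t
      everyOther-hist zero visible
        rewrite hyperObs-visible (H.cops zero) (r zero) (visible ≤-refl) = refl
      everyOther-hist (suc t) visible
        rewrite hyperObs-visible (H.cops (suc t)) (r (suc t)) (visible ≤-refl) =
        cong (just (r (suc t)) ∷_) (everyOther-hist t (λ s≤t → visible (m≤n⇒m≤1+n s≤t)))

      replay-trace : ∀ t → replay (trace t) ≡ C.hist t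
      replay-trace zero = refl
      replay-trace (suc t) = cong (λ h → just (r (suc t)) ∷ h) (begin
        double (trace t)                  ≡⟨ double-trace t ⟩
        just (r t) ∷ replay (trace t)     ≡⟨ cong (just (r t) ∷_) (replay-trace t) ⟩
        just (r t) ∷ C.hist t             ∎)
        where
          open ≡-Reasoning
          double-trace : ∀ t → double (trace t) ≡ just (r t) ∷ replay (trace t)
          double-trace zero = refl
          double-trace (suc t) = refl

      simulation-step : ∀ t → VisibleUpTo t → tail (H.cops t) ≡ C.cops t →
                        tail (H.cops (suc t)) ≡ C.cops (suc t)
      simulation-step t visible agree = begin
        tail (H.cops (suc t))                               ≡⟨ cong tail (cops-visible t (visible ≤-refl)) ⟩
        σ.next (classicalHistory (H.hist t)) (tail (H.cops t)) ≡⟨ cong₂ σ.next history agree ⟩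
        σ.next (C.hist t) (C.cops t)                        ∎
        where
          open ≡-Reasoning
          history : classicalHistory (H.hist t) ≡ C.hist t
          history = trans (cong replay (everyOther-hist t visible)) (replay-trace t)

      simulation : ∀ t → VisibleUpTo t → tail (H.cops t) ≡ C.cops t
      simulation zero _ = refl
      simulation (suc t) visible =
        simulation-step t (λ s≤t → visible (m≤n⇒m≤1+n s≤t))
          (simulation t (λ s≤t → visible (m≤n⇒m≤1+n s≤t)))

      ambush-captures : degree G u ≤ c → ∀ t → HiddenAt t → ∃[ i ] H.cops (suc t) i ≡ r t
      ambush-captures deg≤c t hidden = suc cop , (begin
        H.cops (suc t) (suc cop)                                 ≡⟨ cong (λ C → C (suc cop)) (cops-hidden t hidden) ⟩
        moveOnto (H.cops t (suc cop)) (nth (neighbours u) (toℕ cop)) ≡⟨ cong (moveOnto _) target ⟩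
        moveOnto (H.cops t (suc cop)) (just (r t))               ≡⟨ moveOnto-adjacent _ _ (adjacent (suc cop)) ⟩
        r t                                                      ∎)
        where
          open ≡-Reasoning
          adjacent : ∀ i → Adj G (H.cops t i) (r t)
          adjacent i = Equivalence.to T-≡ (T-all-allFin (λ i → adj (H.cops t i) (r t)) hidden i)
          robber∈N[u] : r t ∈ neighbours u
          robber∈N[u] = ∈-filter⁺ (T? ∘ adj u) (∈-allFin (r t))
            (Equivalence.from T-≡ (subst (λ v → Adj G v (r t)) (guard-stays t) (adjacent zero)))
          cop : Fin c
          cop = inject≤ (index robber∈N[u]) (subst (_≤ c) (sym (length-neighbours u)) deg≤c)
          target : nth (neighbours u) (toℕ cop) ≡ just (r t)
          target = begin
            nth (neighbours u) (toℕ cop)   ≡⟨ cong (nth (neighbours u)) (toℕ-inject≤ _ _) ⟩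
            nth (neighbours u) (toℕ (index robber∈N[u])) ≡⟨ nth-toℕ (neighbours u) (index robber∈N[u]) ⟩
            just (lookup (neighbours u) (index robber∈N[u])) ≡⟨ cong just (lookup-index robber∈N[u]) ⟨
            just (r t)                     ∎

      hiddenAt? : ∀ t → Dec (HiddenAt t)
      hiddenAt? t = T? _

      classical-capture-transfers : ∀ t → VisibleUpTo t → C.CaughtAt t → H.CaughtAt t
      classical-capture-transfers t visible (inj₁ (i , caught)) =
        inj₁ (suc i , trans (cong (λ C → C i) (simulation t visible)) caught)
      classical-capture-transfers t visible (inj₂ (i , caught)) =
        inj₂ (suc i , trans (cong (λ C → C i) next-agrees) caught)
        where
          next-agrees : tail (H.cops (suc t)) ≡ C.cops (suc t)
          next-agrees = simulation-step t visible (simulation t visible)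

      guarded-captures : degree G u ≤ c → ∀ t → C.CaughtAt t → ∃[ s ] H.CaughtAt s
      guarded-captures deg≤c t caught with anyUpTo? hiddenAt? (suc t)
      ... | yes (s , _ , hidden) = s , inj₂ (ambush-captures deg≤c s hidden)
      ... | no neverHidden =
            t , classical-capture-transfers t (λ s≤t hidden → neverHidden (_ , s≤s s≤t , hidden)) caught

  classicalWin⇒hyperopicWin-suc : ∀ c u → degree G u ≤ c → ClassicalWin G c → HyperopicWin G (suc c)
  classicalWin⇒hyperopicWin-suc c u deg≤c (σ , σ-wins) =
    Guarded.guarded c σ u , λ r walk →
      let t , caught = σ-wins r walk in Guarded.guarded-captures c σ u r deg≤c t caught

-- The diameter hypothesis only serves to make G nonempty.
mainTheorem7 : (G : Graph) → Connected G → Diam≥3 G →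
    (c : ℕ) → IsCopNumber G c → minDegree G ≤ c →
    ∃[ j ] (j ≤ suc c × HyperopicWin G j)
mainTheorem7 G _ (v , _) c (classicalWin , _) δ≤c =
  let u , deg≤δ = minDegree-attained G v
  in suc c , ≤-refl , classicalWin⇒hyperopicWin-suc G c u (≤-trans deg≤δ δ≤c) classicalWin
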